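{- For $d\ge1$ let $\Phi_d(x)$ be the indicatrix of the symmetric group $S_d$ acting on $d$ letters. Let $k\ge2$. Then for all $d>k$, $\Phi_d(x)\le\Phi_k(x)$ if $k$ is even and $\Phi_d(x)\ge\Phi_k(x)$ if $k$ is odd, for all $x\in[0,1]$, with equality only when $x=1$.
   Context: For a finite set $\Gamma$ of permutations of a set $X$, the indicatrix of $\Gamma$ is $\Phi_\Gamma(x)=\frac1{\#\Gamma}\sum_{\gamma\in\Gamma}x^{\mathrm{tr}\,\gamma}$, where $\mathrm{tr}\,\gamma$ is the number of points of $X$ fixed by $\gamma$. -}

module Defs where

open import Level using (0ℓ)
open import Data.Nat as ℕ using (ℕ; zero; suc)
open import Data.Fin as Fin using (Fin)
import Data.Fin.Properties as FinP
open import Data.Vec using (Vec; []; _∷_; lookup; toList)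
open import Data.List using (List; []; _∷_; map; concatMap; filter; length; foldr)
open import Data.Sum using (_⊎_)
open import Relation.Binary.PropositionalEquality using (_≡_; _≢_)
open import Relation.Binary.Structures using (IsStrictTotalOrder)
open import Algebra.Structures using (IsCommutativeRing)

-- Ordered fields (the stdlib has no real numbers and no fields).
-- Equality is propositional; the inverse is total with 0⁻¹ unspecified.

record OrderedField : Set₁ where
  infixl 6 _+_
  infixl 7 _*_
  infix 4 _<_ _≤_
  field
    F    : Set
    0# 1# : F
    _+_ _*_ : F → F → F
    -_   : F → F
    _⁻¹  : F → F
    _<_  : F → F → Set
    isCommutativeRing : IsCommutativeRing _≡_ _+_ _*_ -_ 0# 1#
    0≢1        : 0# ≢ 1#
    ⁻¹-inverse : ∀ x → x ≢ 0# → x * (x ⁻¹) ≡ 1#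
    <-isStrictTotalOrder : IsStrictTotalOrder _≡_ _<_
    +-mono-<   : ∀ {a b} c → a < b → a + c < b + c
    *-pos      : ∀ {a b} → 0# < a → 0# < b → 0# < a * b

  _≤_ : F → F → Set
  a ≤ b = a < b ⊎ a ≡ b

  _^_ : F → ℕ → F
  x ^ zero  = 1#
  x ^ suc n = x * (x ^ n)

  fromℕ : ℕ → F
  fromℕ zero    = 0#
  fromℕ (suc n) = 1# + fromℕ n

  sumF : List F → F
  sumF = foldr _+_ 0#

-- The symmetric group S_d acting on the d letters Fin d.
-- A map Fin d → Fin d is represented by the vector of its values;
-- it is a permutation iff it is injective (Unique list of values).

allVecs : (m n : ℕ) → List (Vec (Fin m) n)
allVecs m zero    = [] ∷ []
allVecs m (suc n) = concatMap (λ v → map (_∷ v) (Data.List.allFin m)) (allVecs m n)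
  where import Data.List

Sym : (d : ℕ) → List (Vec (Fin d) d)
Sym d = filter (λ v → unique? (toList v)) (allVecs d d)
  where open import Data.List.Relation.Unary.Unique.DecPropositional (FinP._≟_ {d}) using (unique?)

tr : {d : ℕ} → Vec (Fin d) d → ℕ
tr {d} γ = length (filter (λ i → lookup γ i FinP.≟ i) (Data.List.allFin d))
  where import Data.List

Φ : (K : OrderedField) → ℕ → OrderedField.F K → OrderedField.F K
Φ K d x = (fromℕ (length (Sym d))) ⁻¹ * sumF (map (λ γ → x ^ tr γ) (Sym d))
  where open OrderedField K

module Submission where

-- Weight a word w : Fin n → Fin m by (1 + y) ^ (number of i with w i = τ i), for an injection τ,
-- and sum over the words with distinct letters avoiding a set C disjoint from the image of τ. The
-- sum V s n depends only on n and on the number s = m - n - |C| of spare letters. With all letters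
-- but the first fixed, the first letter is one of s + 1 unused letters, each of weight 1, and the
-- choice τ 0 earns an extra y; accounting for that extra weight by moving τ 0 into C gives
-- V s (n + 1) = (s + 1) V (s + 1) n + y V s n. Hence V 0 (n + 1) = (n + 1) V 0 n + y ^ (n + 1), so
-- Φ_d(x) = V 0 d / d! with y = x - 1 is the partial sum Σ_{j ≤ d} (x - 1) ^ j / j!.
-- For x ∈ [0, 1] and u = 1 - x the terms u ^ j / j! decrease from j = 1 on, so Φ_d - Φ_k is
-- (-1) ^ (k + 1) times an alternating sum of decreasing nonnegative terms; that sum is nonnegative,
-- and at least u ^ (k + 1) / (k + 1)! - u ^ (k + 2) / (k + 2)!, which is positive unless u = 0.

open import Defs
open import Level using (0ℓ)
open import Data.Nat as ℕ using (ℕ; zero; suc; _!)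
import Data.Nat.Properties as ℕₚ
open import Data.Bool using (Bool; true; false; not; _∧_; if_then_else_)
open import Data.Bool.Properties using (∧-conicalˡ; ∧-conicalʳ)
open import Data.Fin using (Fin; zero; suc)
import Data.Fin.Properties as FinP
open FinP using (_≟_)
open import Data.Vec using (Vec; _∷_; lookup; toList)
open import Data.Vec.Properties using (length-toList)
open import Data.List using (List; []; _∷_; _++_; map; concatMap; length; filter; tabulate; allFin)
open import Data.List.Properties using (length-++; ++-identityʳ)
open import Data.List.Relation.Unary.All using (all?)
open import Data.List.Relation.Unary.Unique.Propositional.Properties using (allFin⁺)
open import Data.List.Relation.Binary.Permutation.Propositional using (_↭_; ↭⇒↭ₛ; ↭-sym)
open import Data.List.Relation.Binary.Permutation.Propositional.Properties using (shift)
open import Data.Sum using (_⊎_; inj₁; inj₂)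
open import Data.Product using (_×_; _,_; proj₁; proj₂)
open import Data.Empty using (⊥; ⊥-elim)
open import Function using (_∘_; mk⇔)
open import Relation.Nullary using (does; ¬?; contradiction)
open import Relation.Nullary.Decidable using (Dec; does-⇔; dec-true)
open import Relation.Unary using (Pred; Decidable)
open import Relation.Binary.PropositionalEquality
  using (_≡_; _≢_; refl; sym; trans; cong; cong₂; subst; subst₂; module ≡-Reasoning)
open import Relation.Binary.Structures using (IsStrictTotalOrder)
open import Relation.Binary.Definitions using (tri<; tri≈; tri>)
open import Algebra.Bundles using (CommutativeRing)

module _ {m : ℕ} where
  open import Data.List.Relation.Unary.Unique.DecPropositional (_≟_ {m}) using (unique?)
  open import Data.List.Relation.Binary.Permutation.Setoid.Properties (FinP.≡-setoid m) using (Unique-resp-↭)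

  _∉ᵇ_ : Fin m → List (Fin m) → Bool
  a ∉ᵇ l = does (all? (λ b → ¬? (a ≟ b)) l)

  distinctᵇ : List (Fin m) → Bool
  distinctᵇ l = does (unique? l)

  distinctᵇ-shift : ∀ c xs ys → distinctᵇ (xs ++ c ∷ ys) ≡ distinctᵇ (c ∷ xs ++ ys)
  distinctᵇ-shift c xs ys =
    does-⇔ (mk⇔ (Unique-resp-↭ (↭⇒↭ₛ c↭)) (Unique-resp-↭ (↭⇒↭ₛ (↭-sym c↭)))) (unique? _) (unique? _)
    where
    c↭ : xs ++ c ∷ ys ↭ c ∷ xs ++ ys
    c↭ = shift c xs ys

  distinctᵇ-allFin : distinctᵇ (allFin m) ≡ true
  distinctᵇ-allFin = dec-true (unique? _) (allFin⁺ m)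

length-filter-tabulate : ∀ {a p} {A : Set a} {P : Pred A p} (P? : Decidable P) {n} (f : Fin n → A) →
  length (filter P? (tabulate f)) ≡ length (filter (P? ∘ f) (allFin n))
length-filter-tabulate P? {zero} f = refl
length-filter-tabulate P? {suc n} f with does (P? (f zero))
... | true  = cong suc (trans (length-filter-tabulate P? (f ∘ suc)) (sym (length-filter-tabulate (P? ∘ f) suc)))
... | false = trans (length-filter-tabulate P? (f ∘ suc)) (sym (length-filter-tabulate (P? ∘ f) suc))

agreements : ∀ {m n} → Vec (Fin m) n → (Fin n → Fin m) → ℕ
agreements {n = n} w τ = length (filter (λ i → lookup w i ≟ τ i) (allFin n))

agreements-∷ : ∀ {m n} (a : Fin m) (w : Vec (Fin m) n) (τ : Fin (suc n) → Fin m) →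
  agreements (a ∷ w) τ ≡ (if does (a ≟ τ zero) then suc (agreements w (τ ∘ suc)) else agreements w (τ ∘ suc))
agreements-∷ a w τ with does (a ≟ τ zero)
... | true  = cong suc (length-filter-tabulate (λ i → lookup (a ∷ w) i ≟ τ i) suc)
... | false = length-filter-tabulate (λ i → lookup (a ∷ w) i ≟ τ i) suc

module Properties (K : OrderedField) where
  open OrderedField K
  commutativeRing : CommutativeRing 0ℓ 0ℓ
  commutativeRing = record { isCommutativeRing = isCommutativeRing }
  open CommutativeRing commutativeRing
    using ( +-identityˡ; +-identityʳ; +-assoc; +-comm; *-identityˡ; *-identityʳ; *-assoc; *-comm
          ; distribˡ; distribʳ; zeroˡ; zeroʳ; -‿inverseˡ; -‿inverseʳ
          ; +-commutativeSemigroup; semiring; commutativeSemiring; ring)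
  open import Algebra.Properties.Ring ring
    using (-‿involutive; -‿distribʳ-*; +-cancelˡ; +-cancelʳ; -1*x≈-x; ⁻¹-anti-homo‿-; x∙y⁻¹≈ε⇒x≈y)
  open IsStrictTotalOrder <-isStrictTotalOrder using (compare; irrefl; asym) renaming (trans to <-trans)
  open import Algebra.Properties.CommutativeSemigroup +-commutativeSemigroup using () renaming (interchange to +-interchange)
  open import Algebra.Properties.Semiring.Sum semiring using (sum; sum-cong-≗; ∑-distrib-+; *-distribˡ-sum; sum-replicate-zero)
  open import Algebra.Solver.Ring.NaturalCoefficients.Default commutativeSemiring using (solve; _:=_; _:+_; _:*_; con)
  open ≡-Reasoning

  𝟙 : Bool → F
  𝟙 true  = 1#
  𝟙 false = 0#

  𝟙-∧ : ∀ a b → 𝟙 (a ∧ b) ≡ 𝟙 a * 𝟙 b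
  𝟙-∧ true  b = sym (*-identityˡ (𝟙 b))
  𝟙-∧ false b = sym (zeroˡ (𝟙 b))

  𝟙-not-∧ : ∀ a b → 𝟙 (not a ∧ b) + 𝟙 a * 𝟙 b ≡ 𝟙 b
  𝟙-not-∧ true  b = trans (+-identityˡ _) (*-identityˡ (𝟙 b))
  𝟙-not-∧ false b = trans (cong (𝟙 b +_) (zeroˡ (𝟙 b))) (+-identityʳ (𝟙 b))

  𝟙-*-cong : ∀ b p {q r} → (b ≡ true → q ≡ r) → 𝟙 b * p * q ≡ 𝟙 b * p * r
  𝟙-*-cong true  p q≡r = cong (1# * p *_) (q≡r refl)
  𝟙-*-cong false p {q} {r} _ = trans (cong (_* q) (zeroˡ p)) (trans (zeroˡ q) (sym (trans (cong (_* r) (zeroˡ p)) (zeroˡ r))))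

  fromℕ-+ : ∀ a b → fromℕ (a ℕ.+ b) ≡ fromℕ a + fromℕ b
  fromℕ-+ zero    b = sym (+-identityˡ _)
  fromℕ-+ (suc a) b = trans (cong (1# +_) (fromℕ-+ a b)) (sym (+-assoc _ _ _))

  fromℕ-* : ∀ a b → fromℕ (a ℕ.* b) ≡ fromℕ a * fromℕ b
  fromℕ-* zero    b = sym (zeroˡ _)
  fromℕ-* (suc a) b = begin
    fromℕ (b ℕ.+ a ℕ.* b)            ≡⟨ fromℕ-+ b (a ℕ.* b) ⟩
    fromℕ b + fromℕ (a ℕ.* b)        ≡⟨ cong₂ _+_ (sym (*-identityˡ _)) (fromℕ-* a b) ⟩
    1# * fromℕ b + fromℕ a * fromℕ b ≡⟨ sym (distribʳ _ _ _) ⟩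
    (1# + fromℕ a) * fromℕ b         ∎

  sum-ones : ∀ n → sum {n} (λ _ → 1#) ≡ fromℕ n
  sum-ones zero    = refl
  sum-ones (suc n) = cong (1# +_) (sum-ones n)

  sum-𝟙-≟ : ∀ {n} (c : Fin n) (g : Fin n → F) → sum (λ a → 𝟙 (does (a ≟ c)) * g a) ≡ g c
  sum-𝟙-≟ {suc n} zero g = begin
    1# * g zero + sum (λ a → 0# * g (suc a)) ≡⟨ cong₂ _+_ (*-identityˡ _) (sum-cong-≗ (λ a → zeroˡ (g (suc a)))) ⟩
    g zero + sum {n} (λ _ → 0#)              ≡⟨ cong (g zero +_) (sum-replicate-zero n) ⟩
    g zero + 0#                              ≡⟨ +-identityʳ _ ⟩
    g zero                                   ∎
  sum-𝟙-≟ {suc n} (suc c) g = begin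
    0# * g zero + sum (λ a → 𝟙 (does (a ≟ c)) * g (suc a))
      ≡⟨ cong (_+ sum (λ a → 𝟙 (does (a ≟ c)) * g (suc a))) (zeroˡ (g zero)) ⟩
    0# + sum (λ a → 𝟙 (does (a ≟ c)) * g (suc a)) ≡⟨ +-identityˡ _ ⟩
    sum (λ a → 𝟙 (does (a ≟ c)) * g (suc a))      ≡⟨ sum-𝟙-≟ c (g ∘ suc) ⟩
    g (suc c)                                     ∎

  sum-𝟙-∉ᵇ : ∀ {m} (L : List (Fin m)) → distinctᵇ L ≡ true →
    sum (λ a → 𝟙 (a ∉ᵇ L)) + fromℕ (length L) ≡ fromℕ m
  sum-𝟙-∉ᵇ {m} []      _ = trans (+-identityʳ _) (sum-ones m)
  sum-𝟙-∉ᵇ {m} (y ∷ L) distinct = begin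
    sum out + (1# + fromℕ (length L))         ≡⟨ cong (λ z → sum out + (z + fromℕ (length L))) (sym sum-hit≡1) ⟩
    sum out + (sum hit + fromℕ (length L))    ≡⟨ sym (+-assoc _ _ _) ⟩
    sum out + sum hit + fromℕ (length L)      ≡⟨ cong (_+ fromℕ (length L)) (sym (∑-distrib-+ out hit)) ⟩
    sum (λ a → out a + hit a) + fromℕ (length L)
      ≡⟨ cong (_+ fromℕ (length L)) (sum-cong-≗ {x = λ a → out a + hit a} out+hit≡) ⟩
    sum (λ a → 𝟙 (a ∉ᵇ L)) + fromℕ (length L) ≡⟨ sum-𝟙-∉ᵇ L (∧-conicalʳ (y ∉ᵇ L) (distinctᵇ L) distinct) ⟩
    fromℕ m                                   ∎
    where
    out hit : Fin m → F
    out a = 𝟙 (a ∉ᵇ (y ∷ L))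
    hit a = 𝟙 (does (a ≟ y)) * 𝟙 (a ∉ᵇ L)
    out+hit≡ : ∀ a → out a + hit a ≡ 𝟙 (a ∉ᵇ L)
    out+hit≡ a = 𝟙-not-∧ (does (a ≟ y)) (a ∉ᵇ L)
    sum-hit≡1 : sum hit ≡ 1#
    sum-hit≡1 = trans (sum-𝟙-≟ y (λ a → 𝟙 (a ∉ᵇ L))) (cong 𝟙 (∧-conicalˡ (y ∉ᵇ L) (distinctᵇ L) distinct))

  sum-𝟙-∉ᵇ-weighted : ∀ y {m} k (L : List (Fin m)) (c : Fin m) → distinctᵇ L ≡ true → k ℕ.+ length L ≡ m →
    sum (λ a → 𝟙 (a ∉ᵇ L) * (1# + y * 𝟙 (does (a ≟ c)))) ≡ fromℕ k + y * 𝟙 (c ∉ᵇ L)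
  sum-𝟙-∉ᵇ-weighted y {m} k L c distinct k+L≡m = begin
    sum (λ a → fresh a * (1# + y * isC a))        ≡⟨ sum-cong-≗ (λ a → expand (fresh a) (isC a)) ⟩
    sum (λ a → fresh a + y * (isC a * fresh a))   ≡⟨ ∑-distrib-+ fresh (λ a → y * (isC a * fresh a)) ⟩
    sum fresh + sum (λ a → y * (isC a * fresh a)) ≡⟨ cong₂ _+_ sum-fresh≡k (sym (*-distribˡ-sum y (λ a → isC a * fresh a))) ⟩
    fromℕ k + y * sum (λ a → isC a * fresh a)     ≡⟨ cong (λ z → fromℕ k + y * z) (sum-𝟙-≟ c fresh) ⟩
    fromℕ k + y * fresh c                         ∎
    where
    fresh isC : Fin m → F
    fresh a = 𝟙 (a ∉ᵇ L)
    isC a = 𝟙 (does (a ≟ c))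
    expand : ∀ f e → f * (1# + y * e) ≡ f + y * (e * f)
    expand = solve 3 (λ y f e → f :* (con 1 :+ y :* e) := f :+ y :* (e :* f)) refl y
    sum-fresh≡k : sum fresh ≡ fromℕ k
    sum-fresh≡k = +-cancelʳ (fromℕ (length L)) _ _
      (trans (sum-𝟙-∉ᵇ L distinct) (trans (cong fromℕ (sym k+L≡m)) (fromℕ-+ k (length L))))

  ΣL : {A : Set} → List A → (A → F) → F
  ΣL l f = sumF (map f l)

  ΣL-cong : ∀ {A : Set} (l : List A) {f g : A → F} → (∀ a → f a ≡ g a) → ΣL l f ≡ ΣL l g
  ΣL-cong []      f≗g = refl
  ΣL-cong (a ∷ l) f≗g = cong₂ _+_ (f≗g a) (ΣL-cong l f≗g)

  ΣL-+ : ∀ {A : Set} (l : List A) (f g : A → F) → ΣL l (λ a → f a + g a) ≡ ΣL l f + ΣL l g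
  ΣL-+ []      f g = sym (+-identityˡ 0#)
  ΣL-+ (a ∷ l) f g = trans (cong (f a + g a +_) (ΣL-+ l f g)) (+-interchange _ _ _ _)

  ΣL-*ˡ : ∀ {A : Set} (l : List A) (c : F) (f : A → F) → ΣL l (λ a → c * f a) ≡ c * ΣL l f
  ΣL-*ˡ []      c f = sym (zeroʳ c)
  ΣL-*ˡ (a ∷ l) c f = trans (cong (c * f a +_) (ΣL-*ˡ l c f)) (sym (distribˡ c _ _))

  ΣL-++ : ∀ {A : Set} (l₁ l₂ : List A) (f : A → F) → ΣL (l₁ ++ l₂) f ≡ ΣL l₁ f + ΣL l₂ f
  ΣL-++ []       l₂ f = sym (+-identityˡ _)
  ΣL-++ (a ∷ l₁) l₂ f = trans (cong (f a +_) (ΣL-++ l₁ l₂ f)) (sym (+-assoc _ _ _))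

  ΣL-map : ∀ {A B : Set} (h : A → B) (l : List A) (f : B → F) → ΣL (map h l) f ≡ ΣL l (f ∘ h)
  ΣL-map h []      f = refl
  ΣL-map h (a ∷ l) f = cong (f (h a) +_) (ΣL-map h l f)

  ΣL-tabulate : ∀ {A : Set} {n} (h : Fin n → A) (f : A → F) → ΣL (tabulate h) f ≡ sum (f ∘ h)
  ΣL-tabulate {n = zero}  h f = refl
  ΣL-tabulate {n = suc n} h f = cong (f (h zero) +_) (ΣL-tabulate (h ∘ suc) f)

  ΣL-filter : ∀ {A : Set} {P : A → Set} (P? : ∀ a → Dec (P a)) (l : List A) (f : A → F) →
    ΣL (filter P? l) f ≡ ΣL l (λ a → 𝟙 (does (P? a)) * f a)
  ΣL-filter P? []      f = refl
  ΣL-filter P? (a ∷ l) f with does (P? a)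
  ... | true  = cong₂ _+_ (sym (*-identityˡ (f a))) (ΣL-filter P? l f)
  ... | false = trans (ΣL-filter P? l f) (sym (trans (cong (_+ rest) (zeroˡ (f a))) (+-identityˡ rest)))
    where
    rest : F
    rest = ΣL l (λ a → 𝟙 (does (P? a)) * f a)

  fromℕ-length : ∀ {A : Set} (l : List A) → fromℕ (length l) ≡ ΣL l (λ _ → 1#)
  fromℕ-length []      = refl
  fromℕ-length (a ∷ l) = cong (1# +_) (fromℕ-length l)

  ΣL-allVecs-suc : ∀ m n (f : Vec (Fin m) (suc n) → F) →
    ΣL (allVecs m (suc n)) f ≡ ΣL (allVecs m n) (λ w → sum (λ a → f (a ∷ w)))
  ΣL-allVecs-suc m n f = go (allVecs m n)
    where
    go : ∀ ws → ΣL (concatMap (λ w → map (_∷ w) (allFin m)) ws) f ≡ ΣL ws (λ w → sum (λ a → f (a ∷ w)))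
    go []       = refl
    go (w ∷ ws) = begin
      ΣL (map (_∷ w) (allFin m) ++ concatMap (λ w → map (_∷ w) (allFin m)) ws) f
        ≡⟨ ΣL-++ (map (_∷ w) (allFin m)) _ f ⟩
      ΣL (map (_∷ w) (allFin m)) f + ΣL (concatMap (λ w → map (_∷ w) (allFin m)) ws) f
        ≡⟨ cong₂ _+_ (trans (ΣL-map (_∷ w) (allFin m) f) (ΣL-tabulate (λ a → a) (λ a → f (a ∷ w)))) (go ws) ⟩
      sum (λ a → f (a ∷ w)) + ΣL ws (λ w → sum (λ a → f (a ∷ w))) ∎

  -- Weighted counts of injective words

  -- V s n in the sketch above.
  injectionSum : F → ℕ → ℕ → F
  injectionSum y s zero    = 1#
  injectionSum y s (suc n) = fromℕ (suc s) * injectionSum y (suc s) n + y * injectionSum y s n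

  injectionSum-suc-spare : ∀ y a n →
    injectionSum y a (suc n) + fromℕ (suc n) * injectionSum y (suc a) n ≡ injectionSum y (suc a) (suc n)
  injectionSum-suc-spare y a zero =
    solve 2 (λ A y → (A :* con 1 :+ y :* con 1) :+ (con 1 :+ con 0) :* con 1 := (con 1 :+ A) :* con 1 :+ y :* con 1)
      refl (fromℕ (suc a)) y
  injectionSum-suc-spare y a (suc n) = begin
    (A * V₁₁ + y * V₀₁) + (1# + N) * V₁₁
      ≡⟨ solve 5 (λ A N V₁₁ V₀₁ y → (A :* V₁₁ :+ y :* V₀₁) :+ (con 1 :+ N) :* V₁₁ := (con 1 :+ A) :* V₁₁ :+ N :* V₁₁ :+ y :* V₀₁)
           refl A N V₁₁ V₀₁ y ⟩
    (1# + A) * V₁₁ + N * V₁₁ + y * V₀₁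
      ≡⟨⟩
    (1# + A) * V₁₁ + N * ((1# + A) * V₂₀ + y * V₁₀) + y * V₀₁
      ≡⟨ solve 7 (λ A N V₁₁ V₀₁ V₂₀ V₁₀ y → (con 1 :+ A) :* V₁₁ :+ N :* ((con 1 :+ A) :* V₂₀ :+ y :* V₁₀) :+ y :* V₀₁
                                          := (con 1 :+ A) :* (V₁₁ :+ N :* V₂₀) :+ y :* (V₀₁ :+ N :* V₁₀)) refl A N V₁₁ V₀₁ V₂₀ V₁₀ y ⟩
    (1# + A) * (V₁₁ + N * V₂₀) + y * (V₀₁ + N * V₁₀)
      ≡⟨ cong₂ (λ p q → (1# + A) * p + y * q) (injectionSum-suc-spare y (suc a) n) (injectionSum-suc-spare y a n) ⟩
    injectionSum y (suc a) (suc (suc n)) ∎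
    where
    A N V₀₁ V₁₁ V₁₀ V₂₀ : F
    A = fromℕ (suc a)
    N = fromℕ (suc n)
    V₀₁ = injectionSum y a (suc n)
    V₁₁ = injectionSum y (suc a) (suc n)
    V₁₀ = injectionSum y (suc a) n
    V₂₀ = injectionSum y (suc (suc a)) n

  injectionSum-0-suc : ∀ y n → injectionSum y 0 (suc n) ≡ fromℕ (suc n) * injectionSum y 0 n + y ^ suc n
  injectionSum-0-suc y zero    = refl
  injectionSum-0-suc y (suc n) = begin
    (1# + 0#) * V₁₁ + y * V₀₁
      ≡⟨ cong (λ p → (1# + 0#) * p + y * V₀₁) (sym (injectionSum-suc-spare y 0 n)) ⟩
    (1# + 0#) * (V₀₁ + N * V₁₀) + y * V₀₁
      ≡⟨ cong (λ p → (1# + 0#) * (V₀₁ + N * V₁₀) + y * p) (injectionSum-0-suc y n) ⟩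
    (1# + 0#) * (V₀₁ + N * V₁₀) + y * (N * V₀₀ + Y)
      ≡⟨ solve 6 (λ V₀₁ N V₁₀ y V₀₀ Y → (con 1 :+ con 0) :* (V₀₁ :+ N :* V₁₀) :+ y :* (N :* V₀₀ :+ Y)
                                     := V₀₁ :+ N :* ((con 1 :+ con 0) :* V₁₀ :+ y :* V₀₀) :+ y :* Y) refl V₀₁ N V₁₀ y V₀₀ Y ⟩
    V₀₁ + N * ((1# + 0#) * V₁₀ + y * V₀₀) + y * Y
      ≡⟨⟩
    V₀₁ + N * V₀₁ + y * Y
      ≡⟨ solve 4 (λ V₀₁ N y Y → V₀₁ :+ N :* V₀₁ :+ y :* Y := (con 1 :+ N) :* V₀₁ :+ y :* Y) refl V₀₁ N y Y ⟩
    (1# + N) * V₀₁ + y * Y ∎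
    where
    N Y V₀₀ V₀₁ V₁₀ V₁₁ : F
    N = fromℕ (suc n)
    Y = y ^ suc n
    V₀₀ = injectionSum y 0 n
    V₀₁ = injectionSum y 0 (suc n)
    V₁₀ = injectionSum y 1 n
    V₁₁ = injectionSum y 1 (suc n)

  injectionSum-0#-0≡! : ∀ n → injectionSum 0# 0 n ≡ fromℕ (n !)
  injectionSum-0#-0≡! zero    = sym (+-identityʳ 1#)
  injectionSum-0#-0≡! (suc n) = begin
    injectionSum 0# 0 (suc n)        ≡⟨ injectionSum-0-suc 0# n ⟩
    fromℕ (suc n) * injectionSum 0# 0 n + 0# * 0# ^ n
      ≡⟨ cong₂ (λ p q → fromℕ (suc n) * p + q) (injectionSum-0#-0≡! n) (zeroˡ _) ⟩
    fromℕ (suc n) * fromℕ (n !) + 0# ≡⟨ +-identityʳ _ ⟩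
    fromℕ (suc n) * fromℕ (n !)      ≡⟨ sym (fromℕ-* (suc n) (n !)) ⟩
    fromℕ (suc n !)                 ∎

  ^-if-suc : ∀ y b k → (1# + y) ^ (if b then suc k else k) ≡ (1# + y * 𝟙 b) * (1# + y) ^ k
  ^-if-suc y true  k = cong (λ c → c * (1# + y) ^ k) (cong (1# +_) (sym (*-identityʳ y)))
  ^-if-suc y false k = sym (trans (cong (_* (1# + y) ^ k) (trans (cong (1# +_) (zeroʳ y)) (+-identityʳ 1#))) (*-identityˡ _))

  ^-agreements-∷ : ∀ y {m n} (a : Fin m) (w : Vec (Fin m) n) (τ : Fin (suc n) → Fin m) →
    (1# + y) ^ agreements (a ∷ w) τ ≡ (1# + y * 𝟙 (does (a ≟ τ zero))) * (1# + y) ^ agreements w (τ ∘ suc)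
  ^-agreements-∷ y a w τ = trans (cong ((1# + y) ^_) (agreements-∷ a w τ)) (^-if-suc y (does (a ≟ τ zero)) _)

  wordWeight : F → ∀ {m n} → (Fin n → Fin m) → List (Fin m) → Vec (Fin m) n → F
  wordWeight y τ C w = 𝟙 (distinctᵇ (toList w ++ C)) * (1# + y) ^ agreements w τ

  wordWeight-∷ : ∀ y {m n} (τ : Fin (suc n) → Fin m) C (a : Fin m) (w : Vec (Fin m) n) →
    wordWeight y τ C (a ∷ w) ≡
      wordWeight y (τ ∘ suc) C w * (𝟙 (a ∉ᵇ (toList w ++ C)) * (1# + y * 𝟙 (does (a ≟ τ zero))))
  wordWeight-∷ y {m} τ C a w = begin
    𝟙 (a ∉ᵇ L ∧ distinctᵇ L) * (1# + y) ^ agreements (a ∷ w) τ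
      ≡⟨ cong₂ _*_ (𝟙-∧ (a ∉ᵇ L) (distinctᵇ L)) (^-agreements-∷ y a w τ) ⟩
    (𝟙 (a ∉ᵇ L) * 𝟙 (distinctᵇ L)) * (E * X)
      ≡⟨ solve 4 (λ f d E X → (f :* d) :* (E :* X) := (d :* X) :* (f :* E)) refl (𝟙 (a ∉ᵇ L)) (𝟙 (distinctᵇ L)) E X ⟩
    (𝟙 (distinctᵇ L) * X) * (𝟙 (a ∉ᵇ L) * E) ∎
    where
    L : List (Fin m)
    L = toList w ++ C
    E X : F
    E = 1# + y * 𝟙 (does (a ≟ τ zero))
    X = (1# + y) ^ agreements w (τ ∘ suc)

  wordWeight-cons-used : ∀ y {m n} (τ : Fin n → Fin m) C (c : Fin m) (w : Vec (Fin m) n) →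
    wordWeight y τ (c ∷ C) w ≡ 𝟙 (c ∉ᵇ (toList w ++ C)) * wordWeight y τ C w
  wordWeight-cons-used y {m} τ C c w = begin
    𝟙 (distinctᵇ (toList w ++ c ∷ C)) * X ≡⟨ cong (λ b → 𝟙 b * X) (distinctᵇ-shift c (toList w) C) ⟩
    𝟙 (c ∉ᵇ L ∧ distinctᵇ L) * X          ≡⟨ cong (_* X) (𝟙-∧ (c ∉ᵇ L) (distinctᵇ L)) ⟩
    𝟙 (c ∉ᵇ L) * 𝟙 (distinctᵇ L) * X      ≡⟨ *-assoc _ _ _ ⟩
    𝟙 (c ∉ᵇ L) * (𝟙 (distinctᵇ L) * X)    ∎
    where
    L : List (Fin m)
    L = toList w ++ C
    X : F
    X = (1# + y) ^ agreements w τ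

  sum-wordWeight-∷ : ∀ y {m n} s (τ : Fin (suc n) → Fin m) C (w : Vec (Fin m) n) → suc s ℕ.+ n ℕ.+ length C ≡ m →
    sum (λ a → wordWeight y τ C (a ∷ w)) ≡
      fromℕ (suc s) * wordWeight y (τ ∘ suc) C w + y * wordWeight y (τ ∘ suc) (τ zero ∷ C) w
  sum-wordWeight-∷ y {m} {n} s τ C w length≡ = begin
    sum (λ a → wordWeight y τ C (a ∷ w))
      ≡⟨ sum-cong-≗ (λ a → wordWeight-∷ y τ C a w) ⟩
    sum (λ a → W * (𝟙 (a ∉ᵇ L) * (1# + y * 𝟙 (does (a ≟ τ zero)))))
      ≡⟨ sym (*-distribˡ-sum W (λ a → 𝟙 (a ∉ᵇ L) * (1# + y * 𝟙 (does (a ≟ τ zero))))) ⟩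
    W * sum (λ a → 𝟙 (a ∉ᵇ L) * (1# + y * 𝟙 (does (a ≟ τ zero))))
      ≡⟨⟩
    𝟙 (distinctᵇ L) * X * sum (λ a → 𝟙 (a ∉ᵇ L) * (1# + y * 𝟙 (does (a ≟ τ zero))))
      ≡⟨ 𝟙-*-cong (distinctᵇ L) X (λ distinct → sum-𝟙-∉ᵇ-weighted y (suc s) L (τ zero) distinct length-L) ⟩
    W * (fromℕ (suc s) + y * 𝟙 (τ zero ∉ᵇ L))
      ≡⟨ solve 4 (λ W S y f → W :* (S :+ y :* f) := S :* W :+ y :* (f :* W)) refl W (fromℕ (suc s)) y (𝟙 (τ zero ∉ᵇ L)) ⟩
    fromℕ (suc s) * W + y * (𝟙 (τ zero ∉ᵇ L) * W)
      ≡⟨ cong (λ z → fromℕ (suc s) * W + y * z) (sym (wordWeight-cons-used y (τ ∘ suc) C (τ zero) w)) ⟩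
    fromℕ (suc s) * W + y * wordWeight y (τ ∘ suc) (τ zero ∷ C) w ∎
    where
    L : List (Fin m)
    L = toList w ++ C
    X W : F
    X = (1# + y) ^ agreements w (τ ∘ suc)
    W = wordWeight y (τ ∘ suc) C w
    length-L : suc s ℕ.+ length L ≡ m
    length-L = begin
      suc s ℕ.+ length (toList w ++ C)           ≡⟨ cong (suc s ℕ.+_) (length-++ (toList w)) ⟩
      suc s ℕ.+ (length (toList w) ℕ.+ length C) ≡⟨ cong (λ k → suc s ℕ.+ (k ℕ.+ length C)) (length-toList w) ⟩
      suc s ℕ.+ (n ℕ.+ length C)                 ≡⟨ sym (ℕₚ.+-assoc (suc s) n (length C)) ⟩
      suc s ℕ.+ n ℕ.+ length C                   ≡⟨ length≡ ⟩
      m                                          ∎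

  -- distinctᵇ (tabulate τ ++ C) says at once that τ is injective, that it avoids C, and that C is duplicate-free.
  ΣL-wordWeight : ∀ y {m} n s (τ : Fin n → Fin m) C → s ℕ.+ n ℕ.+ length C ≡ m → distinctᵇ (tabulate τ ++ C) ≡ true →
    ΣL (allVecs m n) (wordWeight y τ C) ≡ injectionSum y s n
  ΣL-wordWeight y zero s τ C _ distinct =
    trans (+-identityʳ _) (trans (cong (λ b → 𝟙 b * 1#) distinct) (*-identityˡ 1#))
  ΣL-wordWeight y {m} (suc n) s τ C length≡ distinct = begin
    ΣL (allVecs m (suc n)) (wordWeight y τ C)
      ≡⟨ ΣL-allVecs-suc m n (wordWeight y τ C) ⟩
    ΣL (allVecs m n) (λ w → sum (λ a → wordWeight y τ C (a ∷ w)))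
      ≡⟨ ΣL-cong (allVecs m n) (λ w → sum-wordWeight-∷ y s τ C w length≡₁) ⟩
    ΣL (allVecs m n) (λ w → fromℕ (suc s) * wordWeight y τ′ C w + y * wordWeight y τ′ (τ zero ∷ C) w)
      ≡⟨ ΣL-+ (allVecs m n) _ _ ⟩
    ΣL (allVecs m n) (λ w → fromℕ (suc s) * wordWeight y τ′ C w) + ΣL (allVecs m n) (λ w → y * wordWeight y τ′ (τ zero ∷ C) w)
      ≡⟨ cong₂ _+_ (ΣL-*ˡ (allVecs m n) _ _) (ΣL-*ˡ (allVecs m n) _ _) ⟩
    fromℕ (suc s) * ΣL (allVecs m n) (wordWeight y τ′ C) + y * ΣL (allVecs m n) (wordWeight y τ′ (τ zero ∷ C))
      ≡⟨ cong₂ (λ p q → fromℕ (suc s) * p + y * q)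
           (ΣL-wordWeight y n (suc s) τ′ C length≡₁ distinct₁)
           (ΣL-wordWeight y n s τ′ (τ zero ∷ C) length≡₂ distinct₂) ⟩
    injectionSum y s (suc n) ∎
    where
    τ′ : Fin n → Fin m
    τ′ = τ ∘ suc
    length≡₁ : suc s ℕ.+ n ℕ.+ length C ≡ m
    length≡₁ = trans (cong (ℕ._+ length C) (sym (ℕₚ.+-suc s n))) length≡
    length≡₂ : s ℕ.+ n ℕ.+ suc (length C) ≡ m
    length≡₂ = trans (ℕₚ.+-suc (s ℕ.+ n) (length C)) length≡₁
    distinct₁ : distinctᵇ (tabulate τ′ ++ C) ≡ true
    distinct₁ = ∧-conicalʳ (τ zero ∉ᵇ (tabulate τ′ ++ C)) _ distinct
    distinct₂ : distinctᵇ (tabulate τ′ ++ τ zero ∷ C) ≡ true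
    distinct₂ = trans (distinctᵇ-shift (τ zero) (tabulate τ′) C) distinct

  ΣL-Sym-^tr : ∀ y d → ΣL (Sym d) (λ γ → (1# + y) ^ tr γ) ≡ injectionSum y 0 d
  ΣL-Sym-^tr y d = begin
    ΣL (Sym d) (λ γ → (1# + y) ^ tr γ)
      ≡⟨ ΣL-filter (λ γ → unique? (toList γ)) (allVecs d d) _ ⟩
    ΣL (allVecs d d) (λ γ → 𝟙 (distinctᵇ (toList γ)) * (1# + y) ^ tr γ)
      ≡⟨ ΣL-cong (allVecs d d) (λ γ → cong (λ l → 𝟙 (distinctᵇ l) * (1# + y) ^ tr γ) (sym (++-identityʳ (toList γ)))) ⟩
    ΣL (allVecs d d) (wordWeight y (λ i → i) [])
      ≡⟨ ΣL-wordWeight y d 0 (λ i → i) [] (ℕₚ.+-identityʳ d) distinct ⟩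
    injectionSum y 0 d ∎
    where
    open import Data.List.Relation.Unary.Unique.DecPropositional (_≟_ {d}) using (unique?)
    distinct : distinctᵇ {d} (tabulate (λ i → i) ++ []) ≡ true
    distinct = trans (cong distinctᵇ (++-identityʳ (allFin d))) (distinctᵇ-allFin {d})

  -1²≡1 : - 1# * - 1# ≡ 1#
  -1²≡1 = trans (-1*x≈-x (- 1#)) (-‿involutive 1#)

  <-irrefl : ∀ {a} → a < a → ⊥
  <-irrefl = irrefl refl

  ≤-trans : ∀ {a b c} → a ≤ b → b ≤ c → a ≤ c
  ≤-trans (inj₁ a<b) (inj₁ b<c) = inj₁ (<-trans a<b b<c)
  ≤-trans (inj₁ a<b) (inj₂ refl) = inj₁ a<b
  ≤-trans (inj₂ refl) b≤c       = b≤c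

  <-≤-trans : ∀ {a b c} → a < b → b ≤ c → a < c
  <-≤-trans a<b (inj₁ b<c) = <-trans a<b b<c
  <-≤-trans a<b (inj₂ refl) = a<b

  ≤-<-trans : ∀ {a b c} → a ≤ b → b < c → a < c
  ≤-<-trans (inj₁ a<b) b<c = <-trans a<b b<c
  ≤-<-trans (inj₂ refl) b<c = b<c

  +-monoˡ-≤ : ∀ c {a b} → a ≤ b → a + c ≤ b + c
  +-monoˡ-≤ c (inj₁ a<b) = inj₁ (+-mono-< c a<b)
  +-monoˡ-≤ c (inj₂ refl) = inj₂ refl

  x+-y+y≡x : ∀ a b → a + - b + b ≡ a
  x+-y+y≡x a b = trans (+-assoc a (- b) b) (trans (cong (a +_) (-‿inverseˡ b)) (+-identityʳ a))

  x<y⇒0<y-x : ∀ {a b} → a < b → 0# < b + - a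
  x<y⇒0<y-x {a} a<b = subst (_< _) (-‿inverseʳ a) (+-mono-< (- a) a<b)

  x≤y⇒0≤y-x : ∀ {a b} → a ≤ b → 0# ≤ b + - a
  x≤y⇒0≤y-x {a} a≤b = subst (_≤ _) (-‿inverseʳ a) (+-monoˡ-≤ (- a) a≤b)

  0≤y-x⇒x≤y : ∀ {a b} → 0# ≤ b + - a → a ≤ b
  0≤y-x⇒x≤y {a} {b} 0≤b-a = subst₂ _≤_ (+-identityˡ a) (x+-y+y≡x b a) (+-monoˡ-≤ a 0≤b-a)

  x≤x+y : ∀ a {b} → 0# ≤ b → a ≤ a + b
  x≤x+y a {b} 0≤b = subst₂ _≤_ (+-identityˡ a) (+-comm b a) (+-monoˡ-≤ a 0≤b)

  x-y≤x : ∀ a {b} → 0# ≤ b → a + - b ≤ a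
  x-y≤x a {b} 0≤b = 0≤y-x⇒x≤y (subst (0# ≤_) (sym a-[a-b]≡b) 0≤b)
    where
    a-[a-b]≡b : a + - (a + - b) ≡ b
    a-[a-b]≡b = trans (cong (a +_) (⁻¹-anti-homo‿- a b)) (trans (+-comm a (b + - a)) (x+-y+y≡x b a))

  -‿antimonoʳ-≤ : ∀ a {b c} → b ≤ c → a + - c ≤ a + - b
  -‿antimonoʳ-≤ a {b} {c} b≤c = 0≤y-x⇒x≤y (subst (0# ≤_) rearrange (x≤y⇒0≤y-x b≤c))
    where
    rearrange : c + - b ≡ a + - b + - (a + - c)
    rearrange = sym (begin
      a + - b + - (a + - c) ≡⟨ cong (a + - b +_) (⁻¹-anti-homo‿- a c) ⟩
      a + - b + (c + - a)   ≡⟨ solve 4 (λ a b′ c a′ → a :+ b′ :+ (c :+ a′) := c :+ b′ :+ (a :+ a′)) refl a (- b) c (- a) ⟩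
      c + - b + (a + - a)   ≡⟨ cong (c + - b +_) (-‿inverseʳ a) ⟩
      c + - b + 0#          ≡⟨ +-identityʳ _ ⟩
      c + - b               ∎)

  0<+ : ∀ {a b} → 0# < a → 0# < b → 0# < a + b
  0<+ {a} {b} 0<a 0<b = <-trans (subst (0# <_) (sym (+-identityˡ b)) 0<b) (+-mono-< b 0<a)

  0≤* : ∀ {a b} → 0# ≤ a → 0# ≤ b → 0# ≤ a * b
  0≤* (inj₁ 0<a) (inj₁ 0<b) = inj₁ (*-pos 0<a 0<b)
  0≤* {a} (inj₁ _) (inj₂ refl) = inj₂ (sym (zeroʳ a))
  0≤* {b = b} (inj₂ refl) _ = inj₂ (sym (zeroˡ b))

  0<1 : 0# < 1#
  0<1 with compare 0# 1#
  ... | tri< 0<1 _ _ = 0<1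
  ... | tri≈ _ 0≡1 _ = ⊥-elim (0≢1 0≡1)
  ... | tri> _ _ 1<0 = ⊥-elim (asym 1<0 (subst (0# <_) -1²≡1 (*-pos 0<-1 0<-1)))
    where
    0<-1 : 0# < - 1#
    0<-1 = subst (0# <_) (+-identityˡ (- 1#)) (x<y⇒0<y-x 1<0)

  0<fromℕ-suc : ∀ n → 0# < fromℕ (suc n)
  0<fromℕ-suc zero    = subst (0# <_) (sym (+-identityʳ 1#)) 0<1
  0<fromℕ-suc (suc n) = 0<+ 0<1 (0<fromℕ-suc n)

  0<fromℕ-! : ∀ n → 0# < fromℕ (n !)
  0<fromℕ-! n with n ! | ℕₚ.1≤n! n
  ... | suc k | _ = 0<fromℕ-suc k

  0<⇒≢0 : ∀ {a} → 0# < a → a ≢ 0#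
  0<⇒≢0 0<a refl = <-irrefl 0<a

  0<⁻¹ : ∀ {a} → 0# < a → 0# < a ⁻¹
  0<⁻¹ {a} 0<a with compare 0# (a ⁻¹)
  ... | tri< 0<a⁻¹ _ _ = 0<a⁻¹
  ... | tri≈ _ 0≡a⁻¹ _ = ⊥-elim (0≢1 (trans (sym (zeroʳ a)) (trans (cong (a *_) 0≡a⁻¹) (⁻¹-inverse a (0<⇒≢0 0<a)))))
  ... | tri> _ _ a⁻¹<0 = ⊥-elim (<-irrefl (subst (0# <_) (-‿inverseʳ 1#) (0<+ 0<1 0<-1)))
    where
    0<-1 : 0# < - 1#
    0<-1 = subst (0# <_) (trans (sym (-‿distribʳ-* a (a ⁻¹))) (cong -_ (⁻¹-inverse a (0<⇒≢0 0<a))))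
             (*-pos 0<a (subst (0# <_) (+-identityˡ _) (x<y⇒0<y-x a⁻¹<0)))

  ⁻¹-inverseˡ : ∀ a → a ≢ 0# → a ⁻¹ * a ≡ 1#
  ⁻¹-inverseˡ a a≢0 = trans (*-comm (a ⁻¹) a) (⁻¹-inverse a a≢0)

  ⁻¹-unique : ∀ {a b} → a * b ≡ 1# → b ≡ a ⁻¹
  ⁻¹-unique {a} {b} ab≡1 = begin
    b              ≡⟨ sym (*-identityˡ b) ⟩
    1# * b         ≡⟨ cong (_* b) (sym (⁻¹-inverseˡ a a≢0)) ⟩
    a ⁻¹ * a * b   ≡⟨ *-assoc _ _ _ ⟩
    a ⁻¹ * (a * b) ≡⟨ cong (a ⁻¹ *_) ab≡1 ⟩
    a ⁻¹ * 1#      ≡⟨ *-identityʳ _ ⟩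
    a ⁻¹           ∎
    where
    a≢0 : a ≢ 0#
    a≢0 refl = 0≢1 (trans (sym (zeroˡ b)) ab≡1)

  ⁻¹-distrib-* : ∀ a b → a ≢ 0# → b ≢ 0# → (a * b) ⁻¹ ≡ a ⁻¹ * b ⁻¹
  ⁻¹-distrib-* a b a≢0 b≢0 = sym (⁻¹-unique (begin
    a * b * (a ⁻¹ * b ⁻¹)
      ≡⟨ solve 4 (λ a b a′ b′ → a :* b :* (a′ :* b′) := (a :* a′) :* (b :* b′)) refl a b (a ⁻¹) (b ⁻¹) ⟩
    (a * a ⁻¹) * (b * b ⁻¹) ≡⟨ cong₂ _*_ (⁻¹-inverse a a≢0) (⁻¹-inverse b b≢0) ⟩
    1# * 1#                 ≡⟨ *-identityˡ 1# ⟩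
    1#                      ∎))

  ⁻¹-*-cancelˡ : ∀ {a} b → a ≢ 0# → a ⁻¹ * (a * b) ≡ b
  ⁻¹-*-cancelˡ {a} b a≢0 = trans (sym (*-assoc _ _ _)) (trans (cong (_* b) (⁻¹-inverseˡ a a≢0)) (*-identityˡ b))

  *-⁻¹-cancelˡ : ∀ {a} b → a ≢ 0# → a * (a ⁻¹ * b) ≡ b
  *-⁻¹-cancelˡ {a} b a≢0 = trans (sym (*-assoc _ _ _)) (trans (cong (_* b) (⁻¹-inverse a a≢0)) (*-identityˡ b))

  0≤^ : ∀ {a} → 0# ≤ a → ∀ j → 0# ≤ a ^ j
  0≤^ 0≤a zero    = inj₁ 0<1
  0≤^ 0≤a (suc j) = 0≤* 0≤a (0≤^ 0≤a j)

  0<^ : ∀ {a} → 0# < a → ∀ j → 0# < a ^ j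
  0<^ 0<a zero    = 0<1
  0<^ 0<a (suc j) = *-pos 0<a (0<^ 0<a j)

  1^n≡1 : ∀ n → 1# ^ n ≡ 1#
  1^n≡1 zero    = refl
  1^n≡1 (suc n) = trans (*-identityˡ _) (1^n≡1 n)

  -- Φ as a partial sum of the exponential series

  expTerm : F → ℕ → F
  expTerm y j = (fromℕ (j !)) ⁻¹ * y ^ j

  expSum : F → ℕ → F
  expSum y zero    = 1#
  expSum y (suc n) = expSum y n + expTerm y (suc n)

  injectionSum-0≡!*expSum : ∀ y n → injectionSum y 0 n ≡ fromℕ (n !) * expSum y n
  injectionSum-0≡!*expSum y zero    = sym (trans (*-identityʳ _) (+-identityʳ 1#))
  injectionSum-0≡!*expSum y (suc n) = begin
    injectionSum y 0 (suc n)           ≡⟨ injectionSum-0-suc y n ⟩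
    fromℕ (suc n) * injectionSum y 0 n + y ^ suc n
      ≡⟨ cong (λ p → fromℕ (suc n) * p + y ^ suc n) (injectionSum-0≡!*expSum y n) ⟩
    fromℕ (suc n) * (fromℕ (n !) * expSum y n) + y ^ suc n
      ≡⟨ cong₂ _+_ (trans (sym (*-assoc _ _ _)) (cong (_* expSum y n) (sym (fromℕ-* (suc n) (n !)))))
                   (sym (*-⁻¹-cancelˡ (y ^ suc n) (0<⇒≢0 (0<fromℕ-! (suc n))))) ⟩
    fromℕ (suc n !) * expSum y n + fromℕ (suc n !) * expTerm y (suc n)
      ≡⟨ sym (distribˡ _ _ _) ⟩
    fromℕ (suc n !) * expSum y (suc n) ∎

  Φ≡expSum : ∀ d x → Φ K d x ≡ expSum (x + - 1#) d
  Φ≡expSum d x = begin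
    (fromℕ (length (Sym d))) ⁻¹ * ΣL (Sym d) (λ γ → x ^ tr γ)
      ≡⟨ cong₂ (λ p q → p ⁻¹ * q) #Sym≡d! ΣL-Sym-x^tr ⟩
    (fromℕ (d !)) ⁻¹ * (fromℕ (d !) * expSum (x + - 1#) d)
      ≡⟨ ⁻¹-*-cancelˡ _ (0<⇒≢0 (0<fromℕ-! d)) ⟩
    expSum (x + - 1#) d ∎
    where
    1+[x-1]≡x : 1# + (x + - 1#) ≡ x
    1+[x-1]≡x = trans (+-comm 1# _) (x+-y+y≡x x 1#)
    #Sym≡d! : fromℕ (length (Sym d)) ≡ fromℕ (d !)
    #Sym≡d! = begin
      fromℕ (length (Sym d))              ≡⟨ fromℕ-length (Sym d) ⟩
      ΣL (Sym d) (λ _ → 1#)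
        ≡⟨ ΣL-cong (Sym d) (λ γ → sym (trans (cong (_^ tr γ) (+-identityʳ 1#)) (1^n≡1 (tr γ)))) ⟩
      ΣL (Sym d) (λ γ → (1# + 0#) ^ tr γ) ≡⟨ ΣL-Sym-^tr 0# d ⟩
      injectionSum 0# 0 d                 ≡⟨ injectionSum-0#-0≡! d ⟩
      fromℕ (d !)                         ∎
    ΣL-Sym-x^tr : ΣL (Sym d) (λ γ → x ^ tr γ) ≡ fromℕ (d !) * expSum (x + - 1#) d
    ΣL-Sym-x^tr = begin
      ΣL (Sym d) (λ γ → x ^ tr γ)                 ≡⟨ ΣL-cong (Sym d) (λ γ → cong (_^ tr γ) (sym 1+[x-1]≡x)) ⟩
      ΣL (Sym d) (λ γ → (1# + (x + - 1#)) ^ tr γ) ≡⟨ ΣL-Sym-^tr (x + - 1#) d ⟩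
      injectionSum (x + - 1#) 0 d                 ≡⟨ injectionSum-0≡!*expSum (x + - 1#) d ⟩
      fromℕ (d !) * expSum (x + - 1#) d           ∎

  -- The alternating tail

  -1*-1*a≡a : ∀ a → - 1# * (- 1# * a) ≡ a
  -1*-1*a≡a a = trans (sym (*-assoc _ _ a)) (trans (cong (_* a) -1²≡1) (*-identityˡ a))

  sign²≡1 : ∀ j → (- 1#) ^ j * (- 1#) ^ j ≡ 1#
  sign²≡1 zero    = *-identityˡ 1#
  sign²≡1 (suc j) = begin
    - 1# * σ * (- 1# * σ) ≡⟨ solve 2 (λ m σ → m :* σ :* (m :* σ) := m :* m :* (σ :* σ)) refl (- 1#) σ ⟩
    - 1# * - 1# * (σ * σ) ≡⟨ cong₂ _*_ -1²≡1 (sign²≡1 j) ⟩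
    1# * 1#               ≡⟨ *-identityˡ 1# ⟩
    1#                    ∎
    where
    σ : F
    σ = (- 1#) ^ j

  sign*a≡0⇒a≡0 : ∀ j {a} → (- 1#) ^ j * a ≡ 0# → a ≡ 0#
  sign*a≡0⇒a≡0 j {a} σa≡0 = begin
    a           ≡⟨ sym (*-identityˡ a) ⟩
    1# * a      ≡⟨ cong (_* a) (sym (sign²≡1 j)) ⟩
    σ * σ * a   ≡⟨ *-assoc σ σ a ⟩
    σ * (σ * a) ≡⟨ cong (σ *_) σa≡0 ⟩
    σ * 0#      ≡⟨ zeroʳ σ ⟩
    0#          ∎
    where
    σ : F
    σ = (- 1#) ^ j

  sign-by-parity : ∀ k → (k ℕ.% 2 ≡ 0 × (- 1#) ^ suc k ≡ - 1#) ⊎ (k ℕ.% 2 ≡ 1 × (- 1#) ^ suc k ≡ 1#)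
  sign-by-parity zero          = inj₁ (refl , *-identityʳ (- 1#))
  sign-by-parity (suc zero)    = inj₂ (refl , trans (cong (- 1# *_) (*-identityʳ (- 1#))) -1²≡1)
  sign-by-parity (suc (suc k)) with sign-by-parity k  -- suc (suc k) % 2 reduces to k % 2
  ... | inj₁ (even , σ≡-1) = inj₁ (even , trans (-1*-1*a≡a _) σ≡-1)
  ... | inj₂ (odd  , σ≡1)  = inj₂ (odd  , trans (-1*-1*a≡a _) σ≡1)

  -‿^ : ∀ a j → (- a) ^ j ≡ (- 1#) ^ j * a ^ j
  -‿^ a zero    = sym (*-identityˡ 1#)
  -‿^ a (suc j) = begin
    - a * (- a) ^ j                 ≡⟨ cong₂ _*_ (sym (-1*x≈-x a)) (-‿^ a j) ⟩
    - 1# * a * ((- 1#) ^ j * a ^ j)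
      ≡⟨ solve 4 (λ m a σ A → m :* a :* (σ :* A) := m :* σ :* (a :* A)) refl (- 1#) a ((- 1#) ^ j) (a ^ j) ⟩
    - 1# * (- 1#) ^ j * (a * a ^ j) ∎

  expTerm-neg : ∀ u j → expTerm (- u) j ≡ (- 1#) ^ j * expTerm u j
  expTerm-neg u j = trans (cong ((fromℕ (j !)) ⁻¹ *_) (-‿^ u j))
    (solve 3 (λ i σ A → i :* (σ :* A) := σ :* (i :* A)) refl ((fromℕ (j !)) ⁻¹) ((- 1#) ^ j) (u ^ j))

  expTerm-suc : ∀ u p → expTerm u (suc p) ≡ expTerm u p * ((fromℕ (suc p)) ⁻¹ * u)
  expTerm-suc u p = begin
    (fromℕ (suc p ℕ.* p !)) ⁻¹ * (u * u ^ p) ≡⟨ cong (λ z → z ⁻¹ * (u * u ^ p)) (fromℕ-* (suc p) (p !)) ⟩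
    (N * P) ⁻¹ * (u * u ^ p)
      ≡⟨ cong (_* (u * u ^ p)) (⁻¹-distrib-* N P (0<⇒≢0 (0<fromℕ-suc p)) (0<⇒≢0 (0<fromℕ-! p))) ⟩
    N ⁻¹ * P ⁻¹ * (u * u ^ p)
      ≡⟨ solve 4 (λ n p u U → n :* p :* (u :* U) := p :* U :* (n :* u)) refl (N ⁻¹) (P ⁻¹) u (u ^ p) ⟩
    P ⁻¹ * u ^ p * (N ⁻¹ * u)                ∎
    where
    N P : F
    N = fromℕ (suc p)
    P = fromℕ (p !)

  expTerm-drop : ∀ u p → expTerm u p + - expTerm u (suc p) ≡ expTerm u p * ((fromℕ (suc p)) ⁻¹ * (fromℕ (suc p) + - u))
  expTerm-drop u p = sym (begin
    e * (N ⁻¹ * (N + - u))      ≡⟨ cong (e *_) (distribˡ (N ⁻¹) N (- u)) ⟩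
    e * (N ⁻¹ * N + N ⁻¹ * - u) ≡⟨ cong (λ z → e * (z + N ⁻¹ * - u)) (⁻¹-inverseˡ N (0<⇒≢0 (0<fromℕ-suc p))) ⟩
    e * (1# + N ⁻¹ * - u)       ≡⟨ distribˡ e 1# _ ⟩
    e * 1# + e * (N ⁻¹ * - u)
      ≡⟨ cong₂ _+_ (*-identityʳ e) (trans (cong (e *_) (sym (-‿distribʳ-* (N ⁻¹) u))) (sym (-‿distribʳ-* e _))) ⟩
    e + - (e * (N ⁻¹ * u))      ≡⟨ cong (λ z → e + - z) (sym (expTerm-suc u p)) ⟩
    e + - expTerm u (suc p)     ∎)
    where
    e N : F
    e = expTerm u p
    N = fromℕ (suc p)

  alternatingTail : F → ℕ → ℕ → F
  alternatingTail u p zero    = 0#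
  alternatingTail u p (suc n) = expTerm u p + - alternatingTail u (suc p) n

  expSum-neg-split : ∀ u k n → expSum (- u) (k ℕ.+ n) ≡ expSum (- u) k + (- 1#) ^ suc k * alternatingTail u (suc k) n
  expSum-neg-split u k zero = begin
    expSum (- u) (k ℕ.+ 0)               ≡⟨ cong (expSum (- u)) (ℕₚ.+-identityʳ k) ⟩
    expSum (- u) k                       ≡⟨ sym (+-identityʳ _) ⟩
    expSum (- u) k + 0#                  ≡⟨ cong (expSum (- u) k +_) (sym (zeroʳ _)) ⟩
    expSum (- u) k + (- 1#) ^ suc k * 0# ∎
  expSum-neg-split u k (suc n) = begin
    expSum (- u) (k ℕ.+ suc n)               ≡⟨ cong (expSum (- u)) (ℕₚ.+-suc k n) ⟩
    expSum (- u) (suc k ℕ.+ n)               ≡⟨ expSum-neg-split u (suc k) n ⟩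
    E + expTerm (- u) (suc k) + - 1# * σ * A ≡⟨ cong (λ z → E + z + - 1# * σ * A) (expTerm-neg u (suc k)) ⟩
    E + σ * e + - 1# * σ * A
      ≡⟨ solve 5 (λ E σ e m A → E :+ σ :* e :+ m :* σ :* A := E :+ σ :* (e :+ m :* A)) refl E σ e (- 1#) A ⟩
    E + σ * (e + - 1# * A)                   ≡⟨ cong (λ z → E + σ * (e + z)) (-1*x≈-x A) ⟩
    E + σ * (e + - A)                        ∎
    where
    E σ e A : F
    E = expSum (- u) k
    σ = (- 1#) ^ suc k
    e = expTerm u (suc k)
    A = alternatingTail u (suc (suc k)) n

  module _ {u : F} (0≤u : 0# ≤ u) (u≤1 : u ≤ 1#) where

    expTerm-nonneg : ∀ j → 0# ≤ expTerm u j
    expTerm-nonneg j = 0≤* (inj₁ (0<⁻¹ (0<fromℕ-! j))) (0≤^ 0≤u j)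

    drop-factor-pos : ∀ q → 0# < (fromℕ (suc (suc q))) ⁻¹ * (fromℕ (suc (suc q)) + - u)
    drop-factor-pos q = *-pos (0<⁻¹ (0<fromℕ-suc (suc q))) (x<y⇒0<y-x (≤-<-trans u≤1 1<N))
      where
      1<N : 1# < 1# + fromℕ (suc q)
      1<N = subst₂ _<_ (+-identityˡ 1#) (+-comm _ 1#) (+-mono-< 1# (0<fromℕ-suc q))

    expTerm-antitone : ∀ q → expTerm u (suc (suc q)) ≤ expTerm u (suc q)
    expTerm-antitone q = 0≤y-x⇒x≤y (subst (0# ≤_) (sym (expTerm-drop u (suc q)))
      (0≤* (expTerm-nonneg (suc q)) (inj₁ (drop-factor-pos q))))

    expTerm-drop-pos : 0# < u → ∀ q → 0# < expTerm u (suc q) + - expTerm u (suc (suc q))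
    expTerm-drop-pos 0<u q = subst (0# <_) (sym (expTerm-drop u (suc q)))
      (*-pos (*-pos (0<⁻¹ (0<fromℕ-! (suc q))) (0<^ 0<u (suc q))) (drop-factor-pos q))

    alternatingTail-bounds : ∀ q n → 0# ≤ alternatingTail u (suc q) n × alternatingTail u (suc q) n ≤ expTerm u (suc q)
    alternatingTail-bounds q zero    = inj₂ refl , expTerm-nonneg (suc q)
    alternatingTail-bounds q (suc n) =
        x≤y⇒0≤y-x (≤-trans (proj₂ next) (expTerm-antitone q))
      , x-y≤x (expTerm u (suc q)) (proj₁ next)
      where
      next : 0# ≤ alternatingTail u (suc (suc q)) n × alternatingTail u (suc (suc q)) n ≤ expTerm u (suc (suc q))
      next = alternatingTail-bounds (suc q) n

    alternatingTail-pos : 0# < u → ∀ q n → 0# < alternatingTail u (suc q) (suc n)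
    alternatingTail-pos 0<u q n = <-≤-trans (expTerm-drop-pos 0<u q)
      (-‿antimonoʳ-≤ (expTerm u (suc q)) (proj₂ (alternatingTail-bounds (suc q) n)))

  Φ-split : ∀ x k n → Φ K (suc k ℕ.+ n) x ≡ Φ K k x + (- 1#) ^ suc k * alternatingTail (1# + - x) (suc k) (suc n)
  Φ-split x k n = begin
    Φ K (suc k ℕ.+ n) x             ≡⟨ cong (λ d → Φ K d x) (sym (ℕₚ.+-suc k n)) ⟩
    Φ K (k ℕ.+ suc n) x             ≡⟨ Φ≡expSum (k ℕ.+ suc n) x ⟩
    expSum (x + - 1#) (k ℕ.+ suc n) ≡⟨ cong (λ y → expSum y (k ℕ.+ suc n)) x-1≡-u ⟩
    expSum (- u) (k ℕ.+ suc n)      ≡⟨ expSum-neg-split u k (suc n) ⟩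
    expSum (- u) k + σA             ≡⟨ cong (_+ σA) (sym (trans (Φ≡expSum k x) (cong (λ y → expSum y k) x-1≡-u))) ⟩
    Φ K k x + σA                    ∎
    where
    u σA : F
    u = 1# + - x
    σA = (- 1#) ^ suc k * alternatingTail u (suc k) (suc n)
    x-1≡-u : x + - 1# ≡ - u
    x-1≡-u = sym (⁻¹-anti-homo‿- 1# x)

  module _ {x : F} (0≤x : 0# ≤ x) (x≤1 : x ≤ 1#) where

    0≤1-x : 0# ≤ 1# + - x
    0≤1-x = x≤y⇒0≤y-x x≤1

    1-x≤1 : 1# + - x ≤ 1#
    1-x≤1 = x-y≤x 1# 0≤x

    module _ (k n : ℕ) where

      tail : F
      tail = alternatingTail (1# + - x) (suc k) (suc n)

      0≤tail : 0# ≤ tail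
      0≤tail = proj₁ (alternatingTail-bounds 0≤1-x 1-x≤1 k (suc n))

      Φ[k+1+n]≤Φ[k] : k ℕ.% 2 ≡ 0 → Φ K (suc k ℕ.+ n) x ≤ Φ K k x
      Φ[k+1+n]≤Φ[k] even with sign-by-parity k
      ... | inj₁ (_ , σ≡-1) = subst (_≤ Φ K k x) (sym Φ≡Φk-tail) (x-y≤x (Φ K k x) 0≤tail)
        where
        Φ≡Φk-tail : Φ K (suc k ℕ.+ n) x ≡ Φ K k x + - tail
        Φ≡Φk-tail = trans (Φ-split x k n) (cong (Φ K k x +_) (trans (cong (_* tail) σ≡-1) (-1*x≈-x tail)))
      ... | inj₂ (odd , _)  = contradiction (trans (sym even) odd) λ ()

      Φ[k]≤Φ[k+1+n] : k ℕ.% 2 ≡ 1 → Φ K k x ≤ Φ K (suc k ℕ.+ n) x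
      Φ[k]≤Φ[k+1+n] odd with sign-by-parity k
      ... | inj₁ (even , _) = contradiction (trans (sym even) odd) λ ()
      ... | inj₂ (_ , σ≡1)  = subst (Φ K k x ≤_) (sym Φ≡Φk+tail) (x≤x+y (Φ K k x) 0≤tail)
        where
        Φ≡Φk+tail : Φ K (suc k ℕ.+ n) x ≡ Φ K k x + tail
        Φ≡Φk+tail = trans (Φ-split x k n) (cong (Φ K k x +_) (trans (cong (_* tail) σ≡1) (*-identityˡ tail)))

      Φ[k+1+n]≡Φ[k]⇒x≡1 : Φ K (suc k ℕ.+ n) x ≡ Φ K k x → x ≡ 1#
      Φ[k+1+n]≡Φ[k]⇒x≡1 Φ-eq with 0≤1-x
      ... | inj₂ 0≡1-x = sym (x∙y⁻¹≈ε⇒x≈y 1# x (sym 0≡1-x))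
      ... | inj₁ 0<1-x = ⊥-elim (<-irrefl (subst (0# <_) tail≡0 (alternatingTail-pos 0≤1-x 1-x≤1 0<1-x k n)))
        where
        tail≡0 : tail ≡ 0#
        tail≡0 = sign*a≡0⇒a≡0 (suc k) (+-cancelˡ (Φ K k x) _ _
          (trans (sym (Φ-split x k n)) (trans Φ-eq (sym (+-identityʳ _)))))

-- Opened only here: inside Properties, _≤_ and _<_ are the order of the field.
open import Data.Nat using (_≤_; _<_; _%_)

lemma3p7 : (K : OrderedField) → (k : ℕ) → 2 ≤ k → (d : ℕ) → k < d →
    (x : OrderedField.F K) →
    OrderedField._≤_ K (OrderedField.0# K) x → OrderedField._≤_ K x (OrderedField.1# K) →
    (k % 2 ≡ 0 → OrderedField._≤_ K (Φ K d x) (Φ K k x)) ×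
    (k % 2 ≡ 1 → OrderedField._≤_ K (Φ K k x) (Φ K d x)) ×
    (Φ K d x ≡ Φ K k x → x ≡ OrderedField.1# K)
lemma3p7 K k _ d k<d x 0≤x x≤1 with ℕₚ.m≤n⇒∃[o]m+o≡n k<d
... | o , refl = Φ[k+1+n]≤Φ[k] 0≤x x≤1 k o , Φ[k]≤Φ[k+1+n] 0≤x x≤1 k o , Φ[k+1+n]≡Φ[k]⇒x≡1 0≤x x≤1 k o
  where open Properties K
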